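{- For every integer $N$ with $1\le N\le 15$ and $N\ne 14$, there does not exist an antipodal $5$-design with $2N$ rational points for the Hermite measure $e^{ -t^2}dt/\sqrt{\pi}$ on $(-\infty,\infty)$.
   Context: An $m$-design with $n$ points for a probability measure $w(t)dt$ on an interval $I$ is a set of $n$ pairwise distinct points $x_1,\dots,x_n\in I$ with $\frac1n\sum_i f(x_i)=\int_I f(t)w(t)dt$ for every real polynomial $f$ of degree at most $m$. It is rational if all $x_i\in\mathbb{Q}$ and antipodal if $\{x_i\}=\{ -x_i\}$. -}

module Defs where

open import Data.Nat using (ℕ; zero; suc; _≤_)
open import Data.Integer using (+_)
open import Data.Rational using (ℚ; 0ℚ; 1ℚ; _+_; _*_; _/_; -_)
open import Data.Fin using (Fin)
import Data.Fin as Fin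
open import Data.List using (List; []; _∷_; length)
open import Data.Product using (Σ; _×_; ∃-syntax)
open import Relation.Binary.PropositionalEquality using (_≡_)
open import Function.Definitions using (Injective)

-- A polynomial with rational coefficients, as its coefficient list
-- [c₀, c₁, …]; f(t) = Σ c_k t^k.  deg f ≤ m  iff  length ≤ m + 1.
Poly : Set
Poly = List ℚ

eval : Poly → ℚ → ℚ
eval []       t = 0ℚ
eval (c ∷ cs) t = c + t * eval cs t

-- Moments ∫ t^k e^{-t²} dt / √π of the Hermite measure:
-- μ₀ = 1, μ₁ = 0, μ_{k+2} = ((k+1)/2) μ_k  (integration by parts).
hermiteMoment : ℕ → ℚ
hermiteMoment zero          = 1ℚ
hermiteMoment (suc zero)    = 0ℚ
hermiteMoment (suc (suc k)) = ((+ suc k) / 2) * hermiteMoment k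

hermiteIntegralFrom : ℕ → Poly → ℚ
hermiteIntegralFrom k []       = 0ℚ
hermiteIntegralFrom k (c ∷ cs) = c * hermiteMoment k + hermiteIntegralFrom (suc k) cs

hermiteIntegral : Poly → ℚ
hermiteIntegral = hermiteIntegralFrom 0

sumFin : ∀ n → (Fin n → ℚ) → ℚ
sumFin zero    f = 0ℚ
sumFin (suc n) f = f Fin.zero + sumFin n (λ i → f (Fin.suc i))

mean : ∀ n → (Fin n → ℚ) → ℚ
mean zero    s = 0ℚ
mean (suc n) s = sumFin (suc n) s * ((+ 1) / suc n)

-- x : Fin n → ℚ is an m-design for the Hermite measure on (-∞,∞)
-- (points rational by construction; every point lies in ℝ).
IsHermiteDesign : (m n : ℕ) → (Fin n → ℚ) → Set
IsHermiteDesign m n x =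
  Injective _≡_ _≡_ x ×
  ((f : Poly) → length f ≤ suc m → mean n (λ i → eval f (x i)) ≡ hermiteIntegral f)

IsAntipodal : (n : ℕ) → (Fin n → ℚ) → Set
IsAntipodal n x = (i : Fin n) → ∃[ j ] (x j ≡ - x i)

{-# OPTIONS --safe #-}
-- The positive points y of an antipodal 2N-point 5-design (at most N of them) satisfy
-- Σ y² = N/2 and Σ y⁴ = 3N/4.  Clearing denominators in 2y gives integers b with at most
-- N nonzero entries and D ≠ 0 such that Σ b² = 2N D² and Σ b⁴ = 12N D⁴.  If D is even,
-- then #{i : b i odd} ≡ Σ b⁴ ≡ 0 (mod 16); as there are at most 15 odd entries, all b i
-- are even and (b/2, D/2) is a smaller solution.  If D is odd, then D¹⁶ ≡ 1 (mod 64), so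
-- after rescaling we may assume Σ b² ≡ 2N and Σ b⁴ ≡ 12N (mod 64).  With k odd entries
-- and j entries ≡ 2 (mod 4), the fourth powers mod 16, 32 and 64 force 12N ≡ k (mod 16),
-- 12N + k ≡ 4N + 8j (mod 32) and, if k = 0, 12N ≡ 16j (mod 64); for k + j ≤ N ≤ 15 this
-- is possible only when N = 14.
module Submission where

open import Algebra.Bundles using (CommutativeSemiring)
open import Data.Fin.Base using (Fin; zero; suc)
open import Data.Nat.Base using (ℕ)

module PowerSums {c ℓ} (R : CommutativeSemiring c ℓ) where
  open CommutativeSemiring R
  open import Algebra.Properties.Semiring.Sum semiring
  open import Algebra.Properties.CommutativeSemiring.Exp R

  powerSum : ∀ {n} → ℕ → (Fin n → Carrier) → Carrier
  powerSum {n} k f = ∑[ i < n ] (f i ^ k)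

  powerSum-*ʳ : ∀ {n} k (f : Fin n → Carrier) c → powerSum k (λ i → f i * c) ≈ powerSum k f * c ^ k
  powerSum-*ʳ k f c =
    trans (sum-cong-≋ (λ i → ^-distrib-* (f i) c k)) (sym (*-distribʳ-sum (c ^ k) (λ i → f i ^ k)))

module ℕ∑ where
  open import Data.Nat.Base using (zero; suc; _+_; _≤_; z≤n)
  import Data.Nat.Properties as ℕP
  open import Function.Base using (_∘_)
  open import Relation.Binary.PropositionalEquality using (_≡_)
  open import Algebra.Properties.Semiring.Sum ℕP.+-*-semiring public

  sum-mono-≤ : ∀ {n} {u v : Fin n → ℕ} → (∀ i → u i ≤ v i) → sum u ≤ sum v
  sum-mono-≤ {zero}  u≤v = z≤n
  sum-mono-≤ {suc n} u≤v = ℕP.+-mono-≤ (u≤v zero) (sum-mono-≤ (u≤v ∘ suc))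

  sum-≤1⇒≤n : ∀ {n} (u : Fin n → ℕ) → (∀ i → u i ≤ 1) → sum u ≤ n
  sum-≤1⇒≤n {zero}  u u≤1 = z≤n
  sum-≤1⇒≤n {suc n} u u≤1 = ℕP.+-mono-≤ (u≤1 zero) (sum-≤1⇒≤n (u ∘ suc) (u≤1 ∘ suc))

  sum≡0⇒≡0 : ∀ {n} (u : Fin n → ℕ) → sum u ≡ 0 → ∀ i → u i ≡ 0
  sum≡0⇒≡0 u ∑u≡0 zero    = ℕP.m+n≡0⇒m≡0 (u zero) ∑u≡0
  sum≡0⇒≡0 u ∑u≡0 (suc i) = sum≡0⇒≡0 (u ∘ suc) (ℕP.m+n≡0⇒n≡0 (u zero) ∑u≡0) i

module Integers where
  open import Data.Nat.Base as ℕ using (zero; suc; z≤n; s≤s)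
  import Data.Nat.Properties as ℕP
  open import Data.Nat.DivMod using (m%n<n)
  open import Data.Nat.Induction using (<-wellFounded)
  open import Data.Integer.Base using (ℤ; +_; -[1+_]; 0ℤ; 1ℤ; _+_; _*_; _-_; -_; ∣_∣; _%ℕ_; _/ℕ_; ≢-nonZero)
  import Data.Integer.Properties as ℤP
  open import Data.Integer.DivMod using (a≡a%ℕn+[a/ℕn]*n; n%ℕd<d)
  open import Data.Integer.Divisibility.Signed
    using (_∣_; divides; _∣?_; ∣m∣n⇒∣m+n; ∣m⇒∣-m; ∣n⇒∣m*n; ∣m⇒∣m*n; ∣-trans)
  open import Data.Integer.Tactic.RingSolver using (solve-∀)
  open import Algebra.Properties.CommutativeSemiring.Exp ℤP.+-*-commutativeSemiring
    using (_^_; ^-distrib-*; ^-assocʳ)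
  open import Algebra.Properties.Semiring.Sum ℤP.+-*-semiring
    using (sum; sum-syntax; ∑-distrib-+; *-distribˡ-sum; sum-cong-≗)
  open PowerSums ℤP.+-*-commutativeSemiring using (powerSum; powerSum-*ʳ)
  open import Data.Bool.Base using (if_then_else_)
  open import Data.Empty using (⊥; ⊥-elim)
  open import Data.Product.Base using (∃; _×_; _,_; proj₁; proj₂)
  open import Data.Sum.Base using (_⊎_; inj₁; inj₂; [_,_]′)
  open import Function.Base using (_∘_)
  open import Induction.WellFounded using (Acc; acc)
  open import Relation.Nullary.Decidable as Dec using (Dec; from-yes; ¬?; _×-dec_; _→-dec_)
  open import Relation.Nullary.Negation using (¬_)
  open import Relation.Binary.PropositionalEquality

  infix 4 _≡_mod_ _≡?_mod_

  record _≡_mod_ (a b : ℤ) (m : ℕ) : Set where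
    constructor ≡mod
    field divides-difference : + m ∣ a - b

  _≡?_mod_ : ∀ a b m → Dec (a ≡ b mod m)
  a ≡? b mod m = Dec.map′ ≡mod _≡_mod_.divides-difference (+ m ∣? a - b)

  module _ {m : ℕ} where

    mod-refl : ∀ {a} → a ≡ a mod m
    mod-refl {a} = ≡mod (divides 0ℤ (trans (ℤP.+-inverseʳ a) (sym (ℤP.*-zeroˡ (+ m)))))

    ≡⇒mod : ∀ {a b} → a ≡ b → a ≡ b mod m
    ≡⇒mod refl = mod-refl

    mod-sym : ∀ {a b} → a ≡ b mod m → b ≡ a mod m
    mod-sym {a} {b} (≡mod m∣a-b) = ≡mod (subst (+ m ∣_) (lemma a b) (∣m⇒∣-m m∣a-b))
      where lemma : ∀ a b → - (a - b) ≡ b - a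
            lemma = solve-∀

    mod-trans : ∀ {a b c} → a ≡ b mod m → b ≡ c mod m → a ≡ c mod m
    mod-trans {a} {b} {c} (≡mod m∣a-b) (≡mod m∣b-c) =
      ≡mod (subst (+ m ∣_) (lemma a b c) (∣m∣n⇒∣m+n m∣a-b m∣b-c))
      where lemma : ∀ a b c → (a - b) + (b - c) ≡ a - c
            lemma = solve-∀

    mod-+ : ∀ {a b c d} → a ≡ b mod m → c ≡ d mod m → a + c ≡ b + d mod m
    mod-+ {a} {b} {c} {d} (≡mod m∣a-b) (≡mod m∣c-d) =
      ≡mod (subst (+ m ∣_) (lemma a b c d) (∣m∣n⇒∣m+n m∣a-b m∣c-d))
      where lemma : ∀ a b c d → (a - b) + (c - d) ≡ (a + c) - (b + d)
            lemma = solve-∀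

    mod-* : ∀ {a b c d} → a ≡ b mod m → c ≡ d mod m → a * c ≡ b * d mod m
    mod-* {a} {b} {c} {d} (≡mod m∣a-b) (≡mod m∣c-d) =
      ≡mod (subst (+ m ∣_) (lemma a b c d) (∣m∣n⇒∣m+n (∣m⇒∣m*n c m∣a-b) (∣n⇒∣m*n b m∣c-d)))
      where lemma : ∀ a b c d → (a - b) * c + b * (c - d) ≡ a * c - b * d
            lemma = solve-∀

    mod-^ : ∀ {a b} k → a ≡ b mod m → a ^ k ≡ b ^ k mod m
    mod-^ zero    a≡b = mod-refl
    mod-^ (suc k) a≡b = mod-* a≡b (mod-^ k a≡b)

    mod-∑ : ∀ {n} {f g : Fin n → ℤ} → (∀ i → f i ≡ g i mod m) → sum f ≡ sum g mod m
    mod-∑ {zero}  f≡g = mod-refl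
    mod-∑ {suc n} f≡g = mod-+ (f≡g zero) (mod-∑ (f≡g ∘ suc))

  mod-weaken : ∀ d {m a b} → a ≡ b mod d ℕ.* m → a ≡ b mod m
  mod-weaken d {m} (≡mod dm∣a-b) = ≡mod (∣-trans (divides (+ d) (ℤP.pos-* d m)) dm∣a-b)

  multiple≡0-mod : ∀ a m → a * + m ≡ 0ℤ mod m
  multiple≡0-mod a m = ≡mod (divides a (ℤP.+-identityʳ (a * + m)))

  -- The parity data of b are read off its residue mod 64, so that every congruence
  -- about a single entry below reduces, through b ≡ residue b (mod 64), to a check
  -- over the 64 residues.
  residue : ℤ → ℕ
  residue b = b %ℕ 64

  ≡residue : ∀ b → b ≡ + residue b mod 64
  ≡residue b = ≡mod (divides (b /ℕ 64)
    (trans (cong (_- + residue b) (a≡a%ℕn+[a/ℕn]*n b 64)) (lemma (+ residue b) (b /ℕ 64 * + 64))))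
    where lemma : ∀ r q → r + q - r ≡ q
          lemma = solve-∀

  isOdd isTwiceOdd : ℕ → ℕ
  isOdd r      = r ℕ.% 2
  isTwiceOdd r = if r ℕ.% 4 ℕ.≡ᵇ 2 then 1 else 0

  odd twiceOdd nonzero : ℤ → ℕ
  odd b      = isOdd (residue b)
  twiceOdd b = isTwiceOdd (residue b)
  nonzero (+ zero) = 0
  nonzero _        = 1

  odd-0-or-1 : ∀ b → odd b ≡ 0 ⊎ odd b ≡ 1
  odd-0-or-1 b with odd b | m%n<n (residue b) 2
  ... | 0           | _               = inj₁ refl
  ... | 1           | _               = inj₂ refl
  ... | suc (suc _) | s≤s (s≤s ())

  fourth-power-mod-16 : ∀ b → b ^ 4 ≡ + odd b mod 16
  fourth-power-mod-16 b = mod-trans (mod-weaken 4 (mod-^ 4 (≡residue b))) (check (n%ℕd<d b 64))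
    where check : ∀ {r} → r ℕ.< 64 → (+ r) ^ 4 ≡ + isOdd r mod 16
          check = from-yes (ℕP.allUpTo? (λ r → (+ r) ^ 4 ≡? + isOdd r mod 16) 64)

  fourth-power-mod-32 : ∀ b → b ^ 4 + + odd b ≡ + 2 * b ^ 2 + + 8 * + twiceOdd b mod 32
  fourth-power-mod-32 b =
    mod-trans (mod-weaken 2 (mod-+ (mod-^ 4 (≡residue b)) mod-refl))
      (mod-trans (check (n%ℕd<d b 64))
        (mod-weaken 2 (mod-+ (mod-* (mod-refl {a = + 2}) (mod-sym (mod-^ 2 (≡residue b)))) mod-refl)))
    where check : ∀ {r} → r ℕ.< 64 → (+ r) ^ 4 + + isOdd r ≡ + 2 * (+ r) ^ 2 + + 8 * + isTwiceOdd r mod 32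
          check = from-yes (ℕP.allUpTo? (λ r →
                    (+ r) ^ 4 + + isOdd r ≡? + 2 * (+ r) ^ 2 + + 8 * + isTwiceOdd r mod 32) 64)

  even-fourth-power-mod-64 : ∀ b → odd b ≡ 0 → b ^ 4 ≡ + 16 * + twiceOdd b mod 64
  even-fourth-power-mod-64 b b-even = mod-trans (mod-^ 4 (≡residue b)) (check (n%ℕd<d b 64) b-even)
    where check : ∀ {r} → r ℕ.< 64 → isOdd r ≡ 0 → (+ r) ^ 4 ≡ + 16 * + isTwiceOdd r mod 64
          check = from-yes (ℕP.allUpTo? (λ r →
                    (isOdd r ℕP.≟ 0) →-dec ((+ r) ^ 4 ≡? + 16 * + isTwiceOdd r mod 64)) 64)

  odd-sixteenth-power-mod-64 : ∀ b → odd b ≡ 1 → b ^ 16 ≡ 1ℤ mod 64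
  odd-sixteenth-power-mod-64 b b-odd = mod-trans (mod-^ 16 (≡residue b)) (check (n%ℕd<d b 64) b-odd)
    where check : ∀ {r} → r ℕ.< 64 → isOdd r ≡ 1 → (+ r) ^ 16 ≡ 1ℤ mod 64
          check = from-yes (ℕP.allUpTo? (λ r → (isOdd r ℕP.≟ 1) →-dec ((+ r) ^ 16 ≡? 1ℤ mod 64)) 64)

  even-halves : ∀ b → odd b ≡ 0 → ∃ λ b′ → b ≡ b′ * + 2
  even-halves b b-even with mod-trans (mod-weaken 32 (≡residue b)) (check (n%ℕd<d b 64) b-even)
    where check : ∀ {r} → r ℕ.< 64 → isOdd r ≡ 0 → + r ≡ 0ℤ mod 2
          check = from-yes (ℕP.allUpTo? (λ r → (isOdd r ℕP.≟ 0) →-dec (+ r ≡? 0ℤ mod 2)) 64)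
  ... | ≡mod (divides b′ b-0≡b′*2) = b′ , trans (sym (ℤP.+-identityʳ b)) b-0≡b′*2

  odd+twiceOdd≤1 : ∀ b → odd b ℕ.+ twiceOdd b ℕ.≤ 1
  odd+twiceOdd≤1 b = check (n%ℕd<d b 64)
    where check : ∀ {r} → r ℕ.< 64 → isOdd r ℕ.+ isTwiceOdd r ℕ.≤ 1
          check = from-yes (ℕP.allUpTo? (λ r → isOdd r ℕ.+ isTwiceOdd r ℕP.≤? 1) 64)

  odd+twiceOdd≤nonzero : ∀ b → odd b ℕ.+ twiceOdd b ℕ.≤ nonzero b
  odd+twiceOdd≤nonzero (+ zero)     = z≤n
  odd+twiceOdd≤nonzero b@(+ suc _)  = odd+twiceOdd≤1 b
  odd+twiceOdd≤nonzero b@(-[1+ _ ]) = odd+twiceOdd≤1 b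

  nonzero≤1 : ∀ b → nonzero b ℕ.≤ 1
  nonzero≤1 (+ zero)    = z≤n
  nonzero≤1 (+ suc _)   = s≤s z≤n
  nonzero≤1 (-[1+ _ ])  = s≤s z≤n

  ∑-pos : ∀ {n} (u : Fin n → ℕ) → ∑[ i < n ] (+ u i) ≡ + ℕ∑.sum u
  ∑-pos {zero}  u = refl
  ∑-pos {suc n} u = trans (cong (_+_ (+ u zero)) (∑-pos (u ∘ suc))) (sym (ℤP.pos-+ (u zero) _))

  count : ∀ {n} → (ℤ → ℕ) → (Fin n → ℤ) → ℕ
  count p b = ℕ∑.sum (p ∘ b)

  module _ {n} (b : Fin n → ℤ) where

    powerSum-4-mod-16 : powerSum 4 b ≡ + count odd b mod 16
    powerSum-4-mod-16 = mod-trans (mod-∑ (fourth-power-mod-16 ∘ b)) (≡⇒mod (∑-pos (odd ∘ b)))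

    powerSum-4-mod-32 : powerSum 4 b + + count odd b ≡ + 2 * powerSum 2 b + + 8 * + count twiceOdd b mod 32
    powerSum-4-mod-32 = mod-trans (≡⇒mod lhs) (mod-trans (mod-∑ (fourth-power-mod-32 ∘ b)) (≡⇒mod rhs))
      where
      lhs : powerSum 4 b + + count odd b ≡ ∑[ i < n ] (b i ^ 4 + + odd (b i))
      lhs = trans (cong (_+_ (powerSum 4 b)) (sym (∑-pos (odd ∘ b))))
                  (sym (∑-distrib-+ (λ i → b i ^ 4) (λ i → + odd (b i))))
      rhs : ∑[ i < n ] (+ 2 * b i ^ 2 + + 8 * + twiceOdd (b i)) ≡ + 2 * powerSum 2 b + + 8 * + count twiceOdd b
      rhs = trans (∑-distrib-+ (λ i → + 2 * b i ^ 2) (λ i → + 8 * + twiceOdd (b i)))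
              (cong₂ _+_ (sym (*-distribˡ-sum (+ 2) (λ i → b i ^ 2)))
                (trans (sym (*-distribˡ-sum (+ 8) (λ i → + twiceOdd (b i))))
                  (cong (+ 8 *_) (∑-pos (twiceOdd ∘ b)))))

    powerSum-4-mod-64 : count odd b ≡ 0 → powerSum 4 b ≡ + 16 * + count twiceOdd b mod 64
    powerSum-4-mod-64 none-odd =
      mod-trans (mod-∑ (λ i → even-fourth-power-mod-64 (b i) (ℕ∑.sum≡0⇒≡0 (odd ∘ b) none-odd i)))
        (≡⇒mod (trans (sym (*-distribˡ-sum (+ 16) (λ i → + twiceOdd (b i))))
                 (cong (+ 16 *_) (∑-pos (twiceOdd ∘ b)))))

    count-odd+twiceOdd≤count-nonzero : count odd b ℕ.+ count twiceOdd b ℕ.≤ count nonzero b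
    count-odd+twiceOdd≤count-nonzero =
      subst (ℕ._≤ count nonzero b) (ℕ∑.∑-distrib-+ (odd ∘ b) (twiceOdd ∘ b))
        (ℕ∑.sum-mono-≤ (odd+twiceOdd≤nonzero ∘ b))

  ParityPattern : ℕ → ℕ → ℕ → Set
  ParityPattern N k j =
    1 ℕ.≤ N × N ≢ 14 × k ℕ.+ j ℕ.≤ N ×
    + 12 * + N ≡ + k mod 16 ×
    + 12 * + N + + k ≡ + 2 * (+ 2 * + N) + + 8 * + j mod 32 ×
    (k ≡ 0 → + 12 * + N ≡ + 16 * + j mod 64)

  no-parity-pattern : ∀ {N k j} → N ℕ.≤ 15 → ¬ ParityPattern N k j
  no-parity-pattern {N} {k} {j} N≤15 p@(_ , _ , k+j≤N , _) =
    check (s≤s N≤15) (s≤s k≤15) (s≤s j≤15) p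
    where
    k≤15 : k ℕ.≤ 15
    k≤15 = ℕP.≤-trans (ℕP.m≤m+n k j) (ℕP.≤-trans k+j≤N N≤15)
    j≤15 : j ℕ.≤ 15
    j≤15 = ℕP.≤-trans (ℕP.m≤n+m j k) (ℕP.≤-trans k+j≤N N≤15)
    pattern? : ∀ N k j → Dec (ParityPattern N k j)
    pattern? N k j =
      (1 ℕP.≤? N) ×-dec ¬? (N ℕP.≟ 14) ×-dec (k ℕ.+ j ℕP.≤? N) ×-dec
      (+ 12 * + N ≡? + k mod 16) ×-dec
      (+ 12 * + N + + k ≡? + 2 * (+ 2 * + N) + + 8 * + j mod 32) ×-dec
      ((k ℕP.≟ 0) →-dec (+ 12 * + N ≡? + 16 * + j mod 64))
    check : ∀ {N} → N ℕ.< 16 → ∀ {k} → k ℕ.< 16 → ∀ {j} → j ℕ.< 16 → ¬ ParityPattern N k j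
    check = from-yes (ℕP.allUpTo? (λ N → ℕP.allUpTo? (λ k → ℕP.allUpTo? (λ j →
              ¬? (pattern? N k j)) 16) 16) 16)

  no-power-sums-mod-64 : ∀ {N n} (b : Fin n → ℤ) → 1 ℕ.≤ N → N ℕ.≤ 15 → N ≢ 14 →
                         count nonzero b ℕ.≤ N →
                         powerSum 2 b ≡ + 2 * + N mod 64 → powerSum 4 b ≡ + 12 * + N mod 64 → ⊥
  no-power-sums-mod-64 b 1≤N N≤15 N≢14 sparse p₂ p₄ = no-parity-pattern N≤15
    ( 1≤N , N≢14 , ℕP.≤-trans (count-odd+twiceOdd≤count-nonzero b) sparse
    , mod-trans (mod-weaken 4 (mod-sym p₄)) (powerSum-4-mod-16 b)
    , mod-trans (mod-weaken 2 (mod-+ (mod-sym p₄) mod-refl))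
        (mod-trans (powerSum-4-mod-32 b) (mod-weaken 2 (mod-+ (mod-* (mod-refl {a = + 2}) p₂) mod-refl)))
    , λ none-odd → mod-trans (mod-sym p₄) (powerSum-4-mod-64 b none-odd))

  *≢0 : ∀ {a c} → a ≢ 0ℤ → c ≢ 0ℤ → a * c ≢ 0ℤ
  *≢0 {a} a≢0 c≢0 ac≡0 = [ a≢0 , c≢0 ]′ (ℤP.i*j≡0⇒i≡0∨j≡0 a ac≡0)

  ^≢0 : ∀ {c} k → c ≢ 0ℤ → c ^ k ≢ 0ℤ
  ^≢0 zero    c≢0 ()
  ^≢0 (suc k) c≢0 = *≢0 c≢0 (^≢0 k c≢0)

  nonzero-≢0 : ∀ {a} → a ≢ 0ℤ → nonzero a ≡ 1
  nonzero-≢0 {+ zero}    a≢0 = ⊥-elim (a≢0 refl)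
  nonzero-≢0 {+ suc _}   _   = refl
  nonzero-≢0 { -[1+ _ ]} _   = refl

  nonzero-*ʳ : ∀ a {c} → c ≢ 0ℤ → nonzero (a * c) ≡ nonzero a
  nonzero-*ʳ (+ zero)     c≢0 = refl
  nonzero-*ʳ a@(+ suc _)  c≢0 = nonzero-≢0 (*≢0 {a} (λ ()) c≢0)
  nonzero-*ʳ a@(-[1+ _ ]) c≢0 = nonzero-≢0 (*≢0 {a} (λ ()) c≢0)

  powerSum-scale : ∀ {n} k {A D} (b : Fin n → ℤ) c →
                   powerSum k b ≡ A * D ^ k → powerSum k (λ i → b i * c) ≡ A * (D * c) ^ k
  powerSum-scale k {A} {D} b c p = begin
    powerSum k (λ i → b i * c) ≡⟨ powerSum-*ʳ k b c ⟩
    powerSum k b * c ^ k       ≡⟨ cong (_* c ^ k) p ⟩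
    A * D ^ k * c ^ k          ≡⟨ ℤP.*-assoc A (D ^ k) (c ^ k) ⟩
    A * (D ^ k * c ^ k)        ≡⟨ cong (A *_) (^-distrib-* D c k) ⟨
    A * (D * c) ^ k            ∎
    where open ≡-Reasoning

  powerSum-cancel : ∀ {n} k {A D} (b : Fin n → ℤ) {c} → c ≢ 0ℤ →
                    powerSum k (λ i → b i * c) ≡ A * (D * c) ^ k → powerSum k b ≡ A * D ^ k
  powerSum-cancel k {A} {D} b {c} c≢0 p = ℤP.*-cancelʳ-≡ _ _ (c ^ k) {{≢-nonZero (^≢0 k c≢0)}} (begin
    powerSum k b * c ^ k       ≡⟨ powerSum-*ʳ k b c ⟨
    powerSum k (λ i → b i * c) ≡⟨ p ⟩
    A * (D * c) ^ k            ≡⟨ cong (A *_) (^-distrib-* D c k) ⟩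
    A * (D ^ k * c ^ k)        ≡⟨ ℤP.*-assoc A (D ^ k) (c ^ k) ⟨
    A * D ^ k * c ^ k          ∎)
    where open ≡-Reasoning

  record IntegralMoments (N : ℕ) {n} (D : ℤ) (b : Fin n → ℤ) : Set where
    field
      sparse  : count nonzero b ℕ.≤ N
      squares : powerSum 2 b ≡ + 2 * + N * D ^ 2
      fourths : powerSum 4 b ≡ + 12 * + N * D ^ 4

  IntegralMoments-cong : ∀ {N n D D′} {b b′ : Fin n → ℤ} → D ≡ D′ → (∀ i → b i ≡ b′ i) →
                         IntegralMoments N D b → IntegralMoments N D′ b′
  IntegralMoments-cong {N} refl b≗b′ M = record
    { sparse  = subst (ℕ._≤ N) (ℕ∑.sum-cong-≗ (cong nonzero ∘ b≗b′)) sparse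
    ; squares = trans (sym (sum-cong-≗ (cong (_^ 2) ∘ b≗b′))) squares
    ; fourths = trans (sym (sum-cong-≗ (cong (_^ 4) ∘ b≗b′))) fourths
    }
    where open IntegralMoments M

  module _ {N n : ℕ} {D c : ℤ} {b : Fin n → ℤ} (c≢0 : c ≢ 0ℤ) where

    count-nonzero-*ʳ : count nonzero (λ i → b i * c) ≡ count nonzero b
    count-nonzero-*ʳ = ℕ∑.sum-cong-≗ (λ i → nonzero-*ʳ (b i) c≢0)

    IntegralMoments-scale : IntegralMoments N D b → IntegralMoments N (D * c) (λ i → b i * c)
    IntegralMoments-scale M = record
      { sparse  = subst (ℕ._≤ N) (sym count-nonzero-*ʳ) sparse
      ; squares = powerSum-scale 2 {+ 2 * + N} {D} b c squares
      ; fourths = powerSum-scale 4 {+ 12 * + N} {D} b c fourths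
      }
      where open IntegralMoments M

    IntegralMoments-cancel : IntegralMoments N (D * c) (λ i → b i * c) → IntegralMoments N D b
    IntegralMoments-cancel M = record
      { sparse  = subst (ℕ._≤ N) count-nonzero-*ʳ sparse
      ; squares = powerSum-cancel 2 {+ 2 * + N} {D} b c≢0 squares
      ; fourths = powerSum-cancel 4 {+ 12 * + N} {D} b c≢0 fourths
      }
      where open IntegralMoments M

  module _ {N n : ℕ} {D : ℤ} {b : Fin n → ℤ} (M : IntegralMoments N D b) where
    open IntegralMoments M

    no-integral-moments-D²≡1 : 1 ℕ.≤ N → N ℕ.≤ 15 → N ≢ 14 → D ^ 2 ≡ 1ℤ mod 64 → ⊥
    no-integral-moments-D²≡1 1≤N N≤15 N≢14 D²≡1 =
      no-power-sums-mod-64 b 1≤N N≤15 N≢14 sparse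
        (mod-trans (≡⇒mod squares) (*-unit D²≡1))
        (mod-trans (≡⇒mod fourths) (*-unit (subst (_≡ 1ℤ mod 64) (^-assocʳ D 2 2) (mod-^ 2 D²≡1))))
      where
      *-unit : ∀ {a u} → u ≡ 1ℤ mod 64 → a * u ≡ a mod 64
      *-unit {a} u≡1 = mod-trans (mod-* (mod-refl {a = a}) u≡1) (≡⇒mod (ℤP.*-identityʳ a))

    even-denominator⇒count-odd≡0 : N ℕ.≤ 15 → odd D ≡ 0 → count odd b ≡ 0
    even-denominator⇒count-odd≡0 N≤15 D-even with even-halves D D-even
    ... | D′ , D≡D′*2 = check (s≤s k≤15) k≡0-mod-16
      where
      k≤15 : count odd b ℕ.≤ 15
      k≤15 = ℕP.≤-trans (ℕP.m≤m+n _ _)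
               (ℕP.≤-trans (count-odd+twiceOdd≤count-nonzero b) (ℕP.≤-trans sparse N≤15))
      fourths-16 : + 12 * + N * D ^ 4 ≡ + 12 * + N * D′ ^ 4 * + 16
      fourths-16 = trans (cong (λ d → + 12 * + N * d ^ 4) D≡D′*2)
                     (trans (cong (+ 12 * + N *_) (^-distrib-* D′ (+ 2) 4))
                       (sym (ℤP.*-assoc (+ 12 * + N) (D′ ^ 4) (+ 16))))
      k≡0-mod-16 : + count odd b ≡ 0ℤ mod 16
      k≡0-mod-16 = mod-trans (mod-sym (powerSum-4-mod-16 b))
                     (mod-trans (≡⇒mod (trans fourths fourths-16)) (multiple≡0-mod (+ 12 * + N * D′ ^ 4) 16))
      check : ∀ {k} → k ℕ.< 16 → + k ≡ 0ℤ mod 16 → k ≡ 0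
      check = from-yes (ℕP.allUpTo? (λ k → (+ k ≡? 0ℤ mod 16) →-dec (k ℕP.≟ 0)) 16)

  ∣i∣<∣i*2∣ : ∀ {i} → i ≢ 0ℤ → ∣ i ∣ ℕ.< ∣ i * + 2 ∣
  ∣i∣<∣i*2∣ {i} i≢0 =
    subst (∣ i ∣ ℕ.<_) (sym (ℤP.abs-* i (+ 2))) (ℕP.m<m*n ∣ i ∣ 2 {{≢-nonZero i≢0}} (s≤s (s≤s z≤n)))

  no-integral-moments : ∀ {N n D} {b : Fin n → ℤ} → 1 ℕ.≤ N → N ℕ.≤ 15 → N ≢ 14 →
                        D ≢ 0ℤ → IntegralMoments N D b → ⊥
  no-integral-moments {N} 1≤N N≤15 N≢14 = descent (<-wellFounded _)
    where
    descent : ∀ {n D} {b : Fin n → ℤ} → Acc ℕ._<_ ∣ D ∣ → D ≢ 0ℤ → IntegralMoments N D b → ⊥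
    descent {D = D} {b} (acc smaller) D≢0 M with odd-0-or-1 D
    -- D¹⁶ ≡ 1 (mod 64) for odd D, so rescaling by D⁷ leaves a denominator D⁸ whose square is 1 mod 64.
    ... | inj₂ D-odd = no-integral-moments-D²≡1 (IntegralMoments-scale (^≢0 7 D≢0) M) 1≤N N≤15 N≢14
                         (subst (_≡ 1ℤ mod 64) (sym (^-assocʳ D 8 2)) (odd-sixteenth-power-mod-64 D D-odd))
    ... | inj₁ D-even with even-halves D D-even
    ...   | D′ , D≡D′*2 =
      descent (smaller (subst (λ d → ∣ D′ ∣ ℕ.< ∣ d ∣) (sym D≡D′*2) (∣i∣<∣i*2∣ D′≢0))) D′≢0
        (IntegralMoments-cancel {D = D′} {b = proj₁ ∘ halves} (λ ())
          (IntegralMoments-cong D≡D′*2 (proj₂ ∘ halves) M))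
      where
      D′≢0 : D′ ≢ 0ℤ
      D′≢0 D′≡0 = D≢0 (trans D≡D′*2 (cong (_* + 2) D′≡0))
      halves : ∀ i → ∃ λ b′ → b i ≡ b′ * + 2
      halves i = even-halves (b i) (ℕ∑.sum≡0⇒≡0 (odd ∘ b) (even-denominator⇒count-odd≡0 M N≤15 D-even) i)

module Rationals where
  open import Data.Nat.Base as ℕ using (zero; suc; z≤n; s≤s)
  import Data.Nat.Properties as ℕP
  open import Data.Integer.Base as ℤ using (ℤ; +_; +0; +[1+_]; -[1+_]; 0ℤ; 1ℤ)
  import Data.Integer.Properties as ℤP
  open import Data.Integer.Tactic.RingSolver using (solve-∀)
  open import Data.Rational.Base using (ℚ; mkℚ; 0ℚ; 1ℚ; _+_; _*_; -_; _/_; ↥_; ↧_)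
  open import Data.Rational.Literals using (fromℤ)
  import Data.Rational.Properties as ℚP
  open import Data.Rational.Solver using (module +-*-Solver)
  open import Data.Rational.Unnormalised.Base using (mkℚᵘ; *≡*)
  import Data.Rational.Unnormalised.Properties as ℚᵘP
  open import Algebra.Bundles using (CommutativeRing)
  open import Level using (0ℓ)
  open import Data.Fin.Permutation using (Permutation′; permutation)
  open import Data.List.Base using ([]; _∷_; length)
  open import Data.Product.Base using (∃₂; _×_; _,_; proj₁; proj₂)
  open import Function.Base using (_∘_)
  open import Function.Definitions using (Injective)
  open import Relation.Binary.PropositionalEquality
  open import Defs using (Poly; eval; hermiteMoment; hermiteIntegralFrom; hermiteIntegral; sumFin; mean;
                          IsHermiteDesign; IsAntipodal)
  open +-*-Solver using (solve; _:+_; _:*_; _:=_; :-_; con)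
  open Integers using (*≢0; nonzero; nonzero≤1; count; IntegralMoments)

  ℚ-commutativeSemiring : CommutativeSemiring 0ℓ 0ℓ
  ℚ-commutativeSemiring = CommutativeRing.commutativeSemiring ℚP.+-*-commutativeRing

  open import Algebra.Properties.CommutativeSemiring.Exp ℚ-commutativeSemiring using (_^_; ^-assocʳ)
  open import Algebra.Properties.Semiring.Sum (CommutativeRing.semiring ℚP.+-*-commutativeRing)
    using (sum; sum-cong-≗; ∑-distrib-+; sum-permute)
  open PowerSums ℚ-commutativeSemiring using (powerSum; powerSum-*ʳ)
  open import Algebra.Properties.CommutativeSemiring.Exp ℤP.+-*-commutativeSemiring using () renaming (_^_ to _^ℤ_)
  import Algebra.Properties.Semiring.Sum ℤP.+-*-semiring as ℤ∑
  module ℤPowerSums = PowerSums ℤP.+-*-commutativeSemiring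

  fromℤ-injective : ∀ {a b} → fromℤ a ≡ fromℤ b → a ≡ b
  fromℤ-injective = cong ↥_

  fromℤ-+ : ∀ a b → fromℤ (a ℤ.+ b) ≡ fromℤ a + fromℤ b
  fromℤ-+ a b = ℚP.toℚᵘ-injective
    (ℚᵘP.≃-sym (ℚᵘP.≃-trans (ℚP.toℚᵘ-homo-+ (fromℤ a) (fromℤ b)) (*≡* (lemma a b))))
    where lemma : ∀ a b → (a ℤ.* + 1 ℤ.+ b ℤ.* + 1) ℤ.* + 1 ≡ (a ℤ.+ b) ℤ.* (+ 1 ℤ.* + 1)
          lemma = solve-∀

  fromℤ-* : ∀ a b → fromℤ (a ℤ.* b) ≡ fromℤ a * fromℤ b
  fromℤ-* a b = ℚP.toℚᵘ-injective
    (ℚᵘP.≃-sym (ℚᵘP.≃-trans (ℚP.toℚᵘ-homo-* (fromℤ a) (fromℤ b)) (*≡* (lemma a b))))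
    where lemma : ∀ a b → (a ℤ.* b) ℤ.* + 1 ≡ (a ℤ.* b) ℤ.* (+ 1 ℤ.* + 1)
          lemma = solve-∀

  fromℤ-^ : ∀ a k → fromℤ (a ^ℤ k) ≡ fromℤ a ^ k
  fromℤ-^ a zero    = refl
  fromℤ-^ a (suc k) = trans (fromℤ-* a (a ^ℤ k)) (cong (fromℤ a *_) (fromℤ-^ a k))

  fromℤ-sum : ∀ {n} (b : Fin n → ℤ) → fromℤ (ℤ∑.sum b) ≡ sum (fromℤ ∘ b)
  fromℤ-sum {zero}  b = refl
  fromℤ-sum {suc n} b = trans (fromℤ-+ (b zero) _) (cong (_+_ (fromℤ (b zero))) (fromℤ-sum (b ∘ suc)))

  fromℤ-powerSum : ∀ {n} k (b : Fin n → ℤ) → fromℤ (ℤPowerSums.powerSum k b) ≡ powerSum k (fromℤ ∘ b)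
  fromℤ-powerSum k b = trans (fromℤ-sum (λ i → b i ^ℤ k)) (sum-cong-≗ (λ i → fromℤ-^ (b i) k))

  *-↧≡↥ : ∀ p → p * fromℤ (↧ p) ≡ fromℤ (↥ p)
  *-↧≡↥ p@(mkℚ n _ _) =
    ℚP.toℚᵘ-injective (ℚᵘP.≃-trans (ℚP.toℚᵘ-homo-* p (fromℤ (↧ p))) (*≡* (lemma n (↧ p))))
    where lemma : ∀ n d → (n ℤ.* d) ℤ.* + 1 ≡ n ℤ.* (d ℤ.* + 1)
          lemma = solve-∀

  ↧≢0 : ∀ p → ↧ p ≢ 0ℤ
  ↧≢0 (mkℚ _ _ _) ()

  commonDenominator : ∀ {n} (z : Fin n → ℚ) →
                      ∃₂ λ (D : ℤ) (b : Fin n → ℤ) → D ≢ 0ℤ × (∀ i → z i * fromℤ D ≡ fromℤ (b i))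
  commonDenominator {zero}  z = 1ℤ , (λ ()) , (λ ()) , (λ ())
  commonDenominator {suc n} z with commonDenominator (z ∘ suc)
  ... | D , b , D≢0 , cleared = ↧ z₀ ℤ.* D , b₀ , *≢0 (↧≢0 z₀) D≢0 , cleared₀
    where
    open ≡-Reasoning
    z₀ : ℚ
    z₀ = z zero
    b₀ : Fin (suc n) → ℤ
    b₀ zero    = ↥ z₀ ℤ.* D
    b₀ (suc i) = b i ℤ.* ↧ z₀
    cleared₀ : ∀ i → z i * fromℤ (↧ z₀ ℤ.* D) ≡ fromℤ (b₀ i)
    cleared₀ zero = begin
      z₀ * fromℤ (↧ z₀ ℤ.* D)         ≡⟨ cong (z₀ *_) (fromℤ-* (↧ z₀) D) ⟩
      z₀ * (fromℤ (↧ z₀) * fromℤ D)   ≡⟨ ℚP.*-assoc z₀ (fromℤ (↧ z₀)) (fromℤ D) ⟨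
      z₀ * fromℤ (↧ z₀) * fromℤ D     ≡⟨ cong (_* fromℤ D) (*-↧≡↥ z₀) ⟩
      fromℤ (↥ z₀) * fromℤ D          ≡⟨ fromℤ-* (↥ z₀) D ⟨
      fromℤ (↥ z₀ ℤ.* D)              ∎
    cleared₀ (suc i) = begin
      z (suc i) * fromℤ (↧ z₀ ℤ.* D)         ≡⟨ cong (z (suc i) *_) (fromℤ-* (↧ z₀) D) ⟩
      z (suc i) * (fromℤ (↧ z₀) * fromℤ D)   ≡⟨ cong (z (suc i) *_) (ℚP.*-comm (fromℤ (↧ z₀)) (fromℤ D)) ⟩
      z (suc i) * (fromℤ D * fromℤ (↧ z₀))   ≡⟨ ℚP.*-assoc (z (suc i)) (fromℤ D) (fromℤ (↧ z₀)) ⟨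
      z (suc i) * fromℤ D * fromℤ (↧ z₀)     ≡⟨ cong (_* fromℤ (↧ z₀)) (cleared i) ⟩
      fromℤ (b i) * fromℤ (↧ z₀)             ≡⟨ fromℤ-* (b i) (↧ z₀) ⟨
      fromℤ (b i ℤ.* ↧ z₀)                   ∎

  powerSum-fromℤ : ∀ {n} k {z : Fin n → ℚ} {D} {b : Fin n → ℤ} → (∀ i → z i * fromℤ D ≡ fromℤ (b i)) →
                   ∀ A → powerSum k z ≡ fromℤ A → ℤPowerSums.powerSum k b ≡ A ℤ.* D ^ℤ k
  powerSum-fromℤ k {z} {D} {b} cleared A p = fromℤ-injective (begin
    fromℤ (ℤPowerSums.powerSum k b)    ≡⟨ fromℤ-powerSum k b ⟩
    powerSum k (fromℤ ∘ b)             ≡⟨ sum-cong-≗ (cong (_^ k) ∘ cleared) ⟨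
    powerSum k (λ i → z i * fromℤ D)   ≡⟨ powerSum-*ʳ k z (fromℤ D) ⟩
    powerSum k z * fromℤ D ^ k         ≡⟨ cong (_* fromℤ D ^ k) p ⟩
    fromℤ A * fromℤ D ^ k              ≡⟨ cong (fromℤ A *_) (fromℤ-^ D k) ⟨
    fromℤ A * fromℤ (D ^ℤ k)           ≡⟨ fromℤ-* A (D ^ℤ k) ⟨
    fromℤ (A ℤ.* D ^ℤ k)               ∎)
    where open ≡-Reasoning

  positivePart : ℚ → ℚ
  positivePart q@(mkℚ +[1+ _ ] _ _) = q
  positivePart _                     = 0ℚ

  isPositive : ℚ → ℕ
  isPositive (mkℚ +[1+ _ ] _ _) = 1
  isPositive _                  = 0

  split-even : (g : ℚ → ℚ) → (∀ q → g (- q) ≡ g q) → g 0ℚ ≡ 0ℚ →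
               ∀ q → g q ≡ g (positivePart q) + g (positivePart (- q))
  split-even g g-even g0≡0 q@(mkℚ +[1+ _ ] _ _) = sym (trans (cong (_+_ (g q)) g0≡0) (ℚP.+-identityʳ (g q)))
  split-even g g-even g0≡0 q@(mkℚ +0 _ _)       =
    trans (cong g (ℚP.↥p≡0⇒p≡0 q refl))
      (trans g0≡0 (sym (trans (cong₂ _+_ g0≡0 g0≡0) (ℚP.+-identityʳ 0ℚ))))
  split-even g g-even g0≡0 q@(mkℚ -[1+ _ ] _ _) =
    sym (trans (cong (_+ g (- q)) g0≡0) (trans (ℚP.+-identityˡ (g (- q))) (g-even q)))

  isPositive-+-neg≤1 : ∀ q → isPositive q ℕ.+ isPositive (- q) ℕ.≤ 1
  isPositive-+-neg≤1 (mkℚ +[1+ _ ] _ _) = s≤s z≤n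
  isPositive-+-neg≤1 (mkℚ +0 _ _)       = z≤n
  isPositive-+-neg≤1 (mkℚ -[1+ _ ] _ _) = s≤s z≤n

  neg-involutive : ∀ q → - (- q) ≡ q
  neg-involutive (mkℚ +[1+ _ ] _ _) = refl
  neg-involutive (mkℚ +0 _ _)       = refl
  neg-involutive (mkℚ -[1+ _ ] _ _) = refl

  neg-^-even : ∀ q m → (- q) ^ (2 ℕ.* m) ≡ q ^ (2 ℕ.* m)
  neg-^-even q m = begin
    (- q) ^ (2 ℕ.* m) ≡⟨ ^-assocʳ (- q) 2 m ⟨
    ((- q) ^ 2) ^ m   ≡⟨ cong (_^ m) (solve 1 (λ q → (:- q) :* ((:- q) :* con 1ℚ) := q :* (q :* con 1ℚ))
                                               refl q) ⟩
    (q ^ 2) ^ m       ≡⟨ ^-assocʳ q 2 m ⟩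
    q ^ (2 ℕ.* m)     ∎
    where open ≡-Reasoning

  module Antipodal {n} {x : Fin n → ℚ} (x-injective : Injective _≡_ _≡_ x) (antipodal : IsAntipodal n x) where

    σ : Fin n → Fin n
    σ i = proj₁ (antipodal i)

    x∘σ : ∀ i → x (σ i) ≡ - x i
    x∘σ i = proj₂ (antipodal i)

    σ-involutive : ∀ i → σ (σ i) ≡ i
    σ-involutive i = x-injective (trans (x∘σ (σ i)) (trans (cong -_ (x∘σ i)) (neg-involutive (x i))))

    σ-permutation : Permutation′ n
    σ-permutation = permutation σ σ σ-involutive σ-involutive

    powerSum-even : ∀ m → let k = 2 ℕ.* suc m in
                    powerSum k x ≡ powerSum k (positivePart ∘ x) + powerSum k (positivePart ∘ x)
    powerSum-even m = begin
      sum (g ∘ x)                  ≡⟨ sum-cong-≗ (split-even g g-even g0≡0 ∘ x) ⟩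
      sum (λ i → g⁺ i + g⁻ i)      ≡⟨ ∑-distrib-+ g⁺ g⁻ ⟩
      sum g⁺ + sum g⁻              ≡⟨ cong (_+_ (sum g⁺)) (sum-cong-≗ (cong (g ∘ positivePart) ∘ x∘σ)) ⟨
      sum g⁺ + sum (g⁺ ∘ σ)        ≡⟨ cong (_+_ (sum g⁺)) (sum-permute g⁺ σ-permutation) ⟨
      sum g⁺ + sum g⁺              ∎
      where
      open ≡-Reasoning
      g : ℚ → ℚ
      g = _^ (2 ℕ.* suc m)
      g-even : ∀ q → g (- q) ≡ g q
      g-even q = neg-^-even q (suc m)
      g0≡0 : g 0ℚ ≡ 0ℚ
      g0≡0 = ℚP.*-zeroˡ (0ℚ ^ ℕ.pred (2 ℕ.* suc m))
      g⁺ g⁻ : Fin n → ℚ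
      g⁺ i = g (positivePart (x i))
      g⁻ i = g (positivePart (- x i))

    count-positive≤half : 2 ℕ.* ℕ∑.sum (isPositive ∘ x) ℕ.≤ n
    count-positive≤half = begin
      2 ℕ.* ℕ∑.sum p                   ≡⟨ cong (ℕ∑.sum p ℕ.+_) (ℕP.+-identityʳ (ℕ∑.sum p)) ⟩
      ℕ∑.sum p ℕ.+ ℕ∑.sum p            ≡⟨ cong (ℕ∑.sum p ℕ.+_) (ℕ∑.sum-permute p σ-permutation) ⟩
      ℕ∑.sum p ℕ.+ ℕ∑.sum (p ∘ σ)      ≡⟨ ℕ∑.∑-distrib-+ p (p ∘ σ) ⟨
      ℕ∑.sum (λ i → p i ℕ.+ p (σ i))   ≤⟨ ℕ∑.sum-≤1⇒≤n _ pair≤1 ⟩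
      n                                ∎
      where
      open ℕP.≤-Reasoning
      p : Fin n → ℕ
      p = isPositive ∘ x
      pair≤1 : ∀ i → p i ℕ.+ p (σ i) ℕ.≤ 1
      pair≤1 i = subst (λ y → p i ℕ.+ isPositive y ℕ.≤ 1) (sym (x∘σ i)) (isPositive-+-neg≤1 (x i))

  monomial : ℕ → Poly
  monomial zero    = 1ℚ ∷ []
  monomial (suc k) = 0ℚ ∷ monomial k

  length-monomial : ∀ k → length (monomial k) ≡ suc k
  length-monomial zero    = refl
  length-monomial (suc k) = cong suc (length-monomial k)

  eval-monomial : ∀ k t → eval (monomial k) t ≡ t ^ k
  eval-monomial zero    t = trans (cong (_+_ 1ℚ) (ℚP.*-zeroʳ t)) (ℚP.+-identityʳ 1ℚ)
  eval-monomial (suc k) t = trans (ℚP.+-identityˡ (t * eval (monomial k) t)) (cong (t *_) (eval-monomial k t))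

  hermiteIntegralFrom-monomial : ∀ j k → hermiteIntegralFrom j (monomial k) ≡ hermiteMoment (j ℕ.+ k)
  hermiteIntegralFrom-monomial j zero    =
    trans (ℚP.+-identityʳ _) (trans (ℚP.*-identityˡ _) (cong hermiteMoment (sym (ℕP.+-identityʳ j))))
  hermiteIntegralFrom-monomial j (suc k) =
    trans (cong (_+ hermiteIntegralFrom (suc j) (monomial k)) (ℚP.*-zeroˡ (hermiteMoment j)))
      (trans (ℚP.+-identityˡ _)
        (trans (hermiteIntegralFrom-monomial (suc j) k) (cong hermiteMoment (sym (ℕP.+-suc j k)))))

  sumFin≡sum : ∀ n (f : Fin n → ℚ) → sumFin n f ≡ sum f
  sumFin≡sum zero    f = refl
  sumFin≡sum (suc n) f = cong (_+_ (f zero)) (sumFin≡sum n (f ∘ suc))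

  1/n*n≡1 : ∀ n → (+ 1 / suc n) * fromℤ (+ suc n) ≡ 1ℚ
  1/n*n≡1 n = ℚP.toℚᵘ-injective (ℚᵘP.≃-trans (ℚP.toℚᵘ-homo-* (+ 1 / suc n) (fromℤ (+ suc n)))
    (ℚᵘP.≃-trans (ℚᵘP.*-cong (ℚP.toℚᵘ-fromℚᵘ (mkℚᵘ (+ 1) n)) ℚᵘP.≃-refl) (*≡* (lemma (+ suc n)))))
    where lemma : ∀ d → (+ 1 ℤ.* d) ℤ.* + 1 ≡ + 1 ℤ.* (d ℤ.* + 1)
          lemma = solve-∀

  design-powerSum : ∀ {m n} {x : Fin (suc n) → ℚ} → IsHermiteDesign m (suc n) x →
                    ∀ {k} → k ℕ.≤ m → powerSum k x ≡ hermiteMoment k * fromℤ (+ suc n)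
  design-powerSum {m} {n} {x} (_ , exact) {k} k≤m = begin
    powerSum k x                             ≡⟨ ℚP.*-identityʳ _ ⟨
    powerSum k x * 1ℚ                        ≡⟨ cong (powerSum k x *_) (1/n*n≡1 n) ⟨
    powerSum k x * (1/n * fromℤ (+ suc n))   ≡⟨ ℚP.*-assoc (powerSum k x) 1/n (fromℤ (+ suc n)) ⟨
    powerSum k x * 1/n * fromℤ (+ suc n)     ≡⟨ cong (_* fromℤ (+ suc n)) mean≡ ⟩
    hermiteMoment k * fromℤ (+ suc n)        ∎
    where
    open ≡-Reasoning
    1/n : ℚ
    1/n = + 1 / suc n
    xᵏ : Fin (suc n) → ℚ
    xᵏ i = eval (monomial k) (x i)
    length≤ : length (monomial k) ℕ.≤ suc m
    length≤ = subst (ℕ._≤ suc m) (sym (length-monomial k)) (s≤s k≤m)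
    mean≡ : powerSum k x * 1/n ≡ hermiteMoment k
    mean≡ = begin
      powerSum k x * 1/n              ≡⟨ cong (_* 1/n) (sum-cong-≗ (eval-monomial k ∘ x)) ⟨
      sum xᵏ * 1/n                    ≡⟨ cong (_* 1/n) (sumFin≡sum (suc n) xᵏ) ⟨
      mean (suc n) xᵏ                 ≡⟨ exact (monomial k) length≤ ⟩
      hermiteIntegral (monomial k)    ≡⟨ hermiteIntegralFrom-monomial 0 k ⟩
      hermiteMoment k                 ∎

  two : ℚ
  two = fromℤ (+ 2)

  nonzero≤isPositive : ∀ q {D b} → positivePart q * two * fromℤ D ≡ fromℤ b → nonzero b ℕ.≤ isPositive q
  nonzero≤isPositive (mkℚ +[1+ _ ] _ _) {b = b} _ = nonzero≤1 b
  nonzero≤isPositive (mkℚ +0 _ _)       {D} eq =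
    ℕP.≤-reflexive (cong nonzero (fromℤ-injective (trans (sym eq) (ℚP.*-zeroˡ (fromℤ D)))))
  nonzero≤isPositive (mkℚ -[1+ _ ] _ _) {D} eq =
    ℕP.≤-reflexive (cong nonzero (fromℤ-injective (trans (sym eq) (ℚP.*-zeroˡ (fromℤ D)))))

  design⇒integralMoments : ∀ N {x : Fin (2 ℕ.* suc N) → ℚ} →
                           IsHermiteDesign 5 (2 ℕ.* suc N) x → IsAntipodal (2 ℕ.* suc N) x →
                           ∃₂ λ D b → D ≢ 0ℤ × IntegralMoments (suc N) D b
  design⇒integralMoments N {x} design@(x-injective , _) antipodal
    with commonDenominator (λ i → positivePart (x i) * two)
  ... | D , b , D≢0 , cleared = D , b , D≢0 , record
    { sparse  = ℕP.*-cancelˡ-≤ 2 (ℕP.≤-trans (ℕP.*-monoʳ-≤ 2 nonzero≤positive) count-positive≤half)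
    ; squares = powerSum-fromℤ 2 {z} cleared (+ 2 ℤ.* + suc N) powerSum-2-z
    ; fourths = powerSum-fromℤ 4 {z} cleared (+ 12 ℤ.* + suc N) powerSum-4-z
    }
    where
    open ≡-Reasoning
    open Antipodal x-injective antipodal
    n : ℕ
    n = 2 ℕ.* suc N
    y z : Fin n → ℚ
    y = positivePart ∘ x
    z i = y i * two
    nonzero≤positive : count nonzero b ℕ.≤ ℕ∑.sum (isPositive ∘ x)
    nonzero≤positive = ℕ∑.sum-mono-≤ (λ i → nonzero≤isPositive (x i) (cleared i))
    powerSum-z : ∀ m → let k = 2 ℕ.* suc m in
                 k ℕ.≤ 5 → powerSum k z ≡ hermiteMoment k * fromℤ (+ n) * two ^ ℕ.pred k
    powerSum-z m k≤5 = begin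
      powerSum k z                                   ≡⟨ powerSum-*ʳ k y two ⟩
      powerSum k y * two ^ k                         ≡⟨ solve 2 (λ s t → s :* (con two :* t) := (s :+ s) :* t)
                                                              refl (powerSum k y) (two ^ ℕ.pred k) ⟩
      (powerSum k y + powerSum k y) * two ^ ℕ.pred k ≡⟨ cong (_* two ^ ℕ.pred k) (powerSum-even m) ⟨
      powerSum k x * two ^ ℕ.pred k                  ≡⟨ cong (_* two ^ ℕ.pred k) (design-powerSum design k≤5) ⟩
      hermiteMoment k * fromℤ (+ n) * two ^ ℕ.pred k ∎
      where k : ℕ
            k = 2 ℕ.* suc m
    powerSum-2-z : powerSum 2 z ≡ fromℤ (+ 2 ℤ.* + suc N)
    powerSum-2-z = begin
      powerSum 2 z                             ≡⟨ powerSum-z 0 (s≤s (s≤s z≤n)) ⟩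
      hermiteMoment 2 * fromℤ (+ n) * two ^ 1  ≡⟨ solve 1 (λ a → con (hermiteMoment 2) :* a :* con (two ^ 1) := a)
                                                         refl (fromℤ (+ n)) ⟩
      fromℤ (+ n)                              ≡⟨ cong fromℤ (ℤP.pos-* 2 (suc N)) ⟩
      fromℤ (+ 2 ℤ.* + suc N)                  ∎
    powerSum-4-z : powerSum 4 z ≡ fromℤ (+ 12 ℤ.* + suc N)
    powerSum-4-z = begin
      powerSum 4 z                             ≡⟨ powerSum-z 1 (s≤s (s≤s (s≤s (s≤s z≤n)))) ⟩
      hermiteMoment 4 * fromℤ (+ n) * two ^ 3  ≡⟨ solve 1 (λ a → con (hermiteMoment 4) :* a :* con (two ^ 3)
                                                              := con (fromℤ (+ 6)) :* a) refl (fromℤ (+ n)) ⟩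
      fromℤ (+ 6) * fromℤ (+ n)                ≡⟨ fromℤ-* (+ 6) (+ n) ⟨
      fromℤ (+ 6 ℤ.* + n)                      ≡⟨ cong (λ a → fromℤ (+ 6 ℤ.* a)) (ℤP.pos-* 2 (suc N)) ⟩
      fromℤ (+ 6 ℤ.* (+ 2 ℤ.* + suc N))        ≡⟨ cong fromℤ (6*2≡12 (+ suc N)) ⟩
      fromℤ (+ 12 ℤ.* + suc N)                 ∎
      where 6*2≡12 : ∀ a → + 6 ℤ.* (+ 2 ℤ.* a) ≡ + 12 ℤ.* a
            6*2≡12 = solve-∀

open import Defs using (IsHermiteDesign; IsAntipodal)
open import Data.Nat using (zero; suc; _≤_; _*_)
open import Data.Rational using (ℚ)
open import Data.Product using (Σ; _×_; _,_)
open import Relation.Binary.PropositionalEquality using (_≢_)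
open import Relation.Nullary using (¬_)
open Integers using (no-integral-moments)
open Rationals using (design⇒integralMoments)

theorem8p4 : (N : ℕ) → 1 ≤ N → N ≤ 15 → N ≢ 14 →
    ¬ Σ (Fin (2 * N) → ℚ) (λ x → IsHermiteDesign 5 (2 * N) x × IsAntipodal (2 * N) x)
theorem8p4 zero    () _ _ _
theorem8p4 (suc N) 1≤N N≤15 N≢14 (x , design , antipodal) =
  let D , b , D≢0 , moments = design⇒integralMoments N design antipodal
  in  no-integral-moments 1≤N N≤15 N≢14 D≢0 moments
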